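{- Over the calculus QHC (described in the context): (a) The $?$-Principle $?(\alpha\to\beta)\leftrightarrow\Box(?\alpha\to ?\beta)$ and the $?^*$-Principle $(?\alpha\to ?\beta)\leftrightarrow ?(\nabla\alpha\to\nabla\beta)$, taken together, are equivalent to $?(\alpha\to\beta)\leftrightarrow(?\alpha\to ?\beta)$. (b) The $\forall$-Principle $?\forall x\,\alpha(x)\leftrightarrow\Box\forall x\,?\alpha(x)$ and the $\forall^*$-Principle $\forall x\,?\alpha(x)\leftrightarrow ?\forall x\,\nabla\alpha(x)$, taken together, are equivalent to $?\forall x\,\alpha(x)\leftrightarrow\forall x\,?\alpha(x)$. (c) The $\lor$-Principle $!(p\lor q)\leftrightarrow\nabla(!p\lor !q)$ and the $\lor^*$-Principle $!p\lor !q\leftrightarrow !(\Box p\lor\Box q)$, taken together, are equivalent to $!(p\lor q)\leftrightarrow(!p\lor !q)$. (d) The $\exists$-Principle $!\exists x\,p(x)\leftrightarrow\nabla\exists x\,!p(x)$ and the $\exists^*$-Principle $\exists x\,!p(x)\leftrightarrow !\exists x\,\Box p(x)$, taken together, are equivalent to $!\exists x\,p(x)\leftrightarrow\exists x\,!p(x)$.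
   Context: QHC (the joint logic of problems and propositions) is a two-sorted first-order calculus over a single domain of individuals. Formulas are of two sorts: propositions (letters $p,q$) and problems (letters $\alpha,\beta$). Propositions are built from atomic propositions and from expressions $?\alpha$ ($\alpha$ a problem) by the classical connectives $\land,\lor,\to,\neg$, the constant $0$ (falsity) and quantifiers $\forall x,\exists x$. Problems are built from atomic problems and from expressions $!p$ ($p$ a proposition) by the intuitionistic connectives $\land,\lor,\to,\neg$, the constant $\bot$ and quantifiers $\forall x,\exists x$. Derivability in QHC: all axioms and rules of classical predicate logic apply to propositions, all axioms and rules of intuitionistic predicate logic apply to problems, and in addition there are the inference rules "from $\alpha$ infer $?\alpha$" and "from $p$ infer $!p$", and the axiom schemes $?(\alpha\to\beta)\to(?\alpha\to ?\beta)$, $!(p\to q)\to(!p\to !q)$, $\neg !0$, $?!p\to p$, $\alpha\to !?\alpha$. Abbreviations: $\Box p:= ?!p$ for propositions, $\nabla\alpha := !?\alpha$ for problems; $A\leftrightarrow B$ abbreviates $(A\to B)\land(B\to A)$ in the appropriate sort. A "principle" is a schema added to QHC as extra axioms (all instances, for arbitrary formulas of the indicated sorts and variables $x$). Two (sets of) principles are equivalent if each is derivable in QHC extended by the other. -}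

module Defs where

open import Data.Nat using (ℕ; zero; suc)
open import Data.List using (List; map)
open import Data.Product using (Σ; _×_; _,_)
open import Data.Sum using (_⊎_)
open import Relation.Binary.PropositionalEquality using (_≡_)

-- Syntax of QHC (de Bruijn indices; terms are individual variables)

Var : Set
Var = ℕ

infixr 6 _∧ᵖ_ _∧ᵇ_
infixr 5 _∨ᵖ_ _∨ᵇ_
infixr 4 _⇒ᵖ_ _⇒ᵇ_
infix  3 _⇔ᵖ_ _⇔ᵇ_

mutual
  data Prop : Set where
    patom : ℕ → List Var → Prop
    ⁇_    : Prob → Prop
    _∧ᵖ_  : Prop → Prop → Prop
    _∨ᵖ_  : Prop → Prop → Prop
    _⇒ᵖ_  : Prop → Prop → Prop
    ¬ᵖ_   : Prop → Prop
    𝟘     : Prop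
    ∀ᵖ_   : Prop → Prop
    ∃ᵖ_   : Prop → Prop

  data Prob : Set where
    batom : ℕ → List Var → Prob
    !_    : Prop → Prob
    _∧ᵇ_  : Prob → Prob → Prob
    _∨ᵇ_  : Prob → Prob → Prob
    _⇒ᵇ_  : Prob → Prob → Prob
    ¬ᵇ_   : Prob → Prob
    ⊥ᵇ    : Prob
    ∀ᵇ_   : Prob → Prob
    ∃ᵇ_   : Prob → Prob

infix 8 ⁇_ !_ ¬ᵖ_ ¬ᵇ_ □_ ∇_
infix 7 ∀ᵖ_ ∃ᵖ_ ∀ᵇ_ ∃ᵇ_

□_ : Prop → Prop
□ p = ⁇ (! p)

∇_ : Prob → Prob
∇ α = ! (⁇ α)

_⇔ᵖ_ : Prop → Prop → Prop
p ⇔ᵖ q = (p ⇒ᵖ q) ∧ᵖ (q ⇒ᵖ p)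

_⇔ᵇ_ : Prob → Prob → Prob
α ⇔ᵇ β = (α ⇒ᵇ β) ∧ᵇ (β ⇒ᵇ α)

lift : (Var → Var) → Var → Var
lift ρ zero    = zero
lift ρ (suc n) = suc (ρ n)

mutual
  renP : (Var → Var) → Prop → Prop
  renP ρ (patom i xs) = patom i (map ρ xs)
  renP ρ (⁇ α)        = ⁇ (renB ρ α)
  renP ρ (p ∧ᵖ q)     = renP ρ p ∧ᵖ renP ρ q
  renP ρ (p ∨ᵖ q)     = renP ρ p ∨ᵖ renP ρ q
  renP ρ (p ⇒ᵖ q)     = renP ρ p ⇒ᵖ renP ρ q
  renP ρ (¬ᵖ p)       = ¬ᵖ renP ρ p
  renP ρ 𝟘            = 𝟘
  renP ρ (∀ᵖ p)       = ∀ᵖ renP (lift ρ) p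
  renP ρ (∃ᵖ p)       = ∃ᵖ renP (lift ρ) p

  renB : (Var → Var) → Prob → Prob
  renB ρ (batom i xs) = batom i (map ρ xs)
  renB ρ (! p)        = ! (renP ρ p)
  renB ρ (α ∧ᵇ β)     = renB ρ α ∧ᵇ renB ρ β
  renB ρ (α ∨ᵇ β)     = renB ρ α ∨ᵇ renB ρ β
  renB ρ (α ⇒ᵇ β)     = renB ρ α ⇒ᵇ renB ρ β
  renB ρ (¬ᵇ α)       = ¬ᵇ renB ρ α
  renB ρ ⊥ᵇ           = ⊥ᵇ
  renB ρ (∀ᵇ α)       = ∀ᵇ renB (lift ρ) α
  renB ρ (∃ᵇ α)       = ∃ᵇ renB (lift ρ) α

inst : Var → Var → Var
inst t zero    = t
inst t (suc n) = n

_[_]ᵖ : Prop → Var → Prop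
p [ t ]ᵖ = renP (inst t) p

_[_]ᵇ : Prob → Var → Prob
α [ t ]ᵇ = renB (inst t) α

wkP : Prop → Prop
wkP = renP suc

wkB : Prob → Prob
wkB = renB suc

record Ext : Set₁ where
  field
    PAx : Prop → Set
    BAx : Prob → Set
open Ext public

data Empty : Set where

QHC₀ : Ext
QHC₀ = record { PAx = λ _ → Empty ; BAx = λ _ → Empty }

-- union of two principles ("taken together")
_∪_ : Ext → Ext → Ext
E ∪ F = record { PAx = λ p → PAx E p ⊎ PAx F p ; BAx = λ α → BAx E α ⊎ BAx F α }

infix 2 _⊢ᵖ_ _⊢ᵇ_

mutual
  data _⊢ᵖ_ (E : Ext) : Prop → Set where
    axP  : ∀ {p} → PAx E p → E ⊢ᵖ p
    K    : ∀ {p q} → E ⊢ᵖ p ⇒ᵖ q ⇒ᵖ p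
    S    : ∀ {p q r} → E ⊢ᵖ (p ⇒ᵖ q ⇒ᵖ r) ⇒ᵖ (p ⇒ᵖ q) ⇒ᵖ p ⇒ᵖ r
    ∧I   : ∀ {p q} → E ⊢ᵖ p ⇒ᵖ q ⇒ᵖ p ∧ᵖ q
    ∧E₁  : ∀ {p q} → E ⊢ᵖ p ∧ᵖ q ⇒ᵖ p
    ∧E₂  : ∀ {p q} → E ⊢ᵖ p ∧ᵖ q ⇒ᵖ q
    ∨I₁  : ∀ {p q} → E ⊢ᵖ p ⇒ᵖ p ∨ᵖ q
    ∨I₂  : ∀ {p q} → E ⊢ᵖ q ⇒ᵖ p ∨ᵖ q
    ∨E   : ∀ {p q r} → E ⊢ᵖ (p ⇒ᵖ r) ⇒ᵖ (q ⇒ᵖ r) ⇒ᵖ p ∨ᵖ q ⇒ᵖ r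
    𝟘E   : ∀ {p} → E ⊢ᵖ 𝟘 ⇒ᵖ p
    ¬I   : ∀ {p} → E ⊢ᵖ (p ⇒ᵖ 𝟘) ⇒ᵖ ¬ᵖ p
    ¬E   : ∀ {p} → E ⊢ᵖ ¬ᵖ p ⇒ᵖ p ⇒ᵖ 𝟘
    DNE  : ∀ {p} → E ⊢ᵖ ¬ᵖ ¬ᵖ p ⇒ᵖ p
    ∀E   : ∀ {p} t → E ⊢ᵖ ∀ᵖ p ⇒ᵖ p [ t ]ᵖ
    ∃I   : ∀ {p} t → E ⊢ᵖ p [ t ]ᵖ ⇒ᵖ ∃ᵖ p
    mp   : ∀ {p q} → E ⊢ᵖ p ⇒ᵖ q → E ⊢ᵖ p → E ⊢ᵖ q
    ∀R   : ∀ {p q} → E ⊢ᵖ wkP q ⇒ᵖ p → E ⊢ᵖ q ⇒ᵖ ∀ᵖ p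
    ∃R   : ∀ {p q} → E ⊢ᵖ p ⇒ᵖ wkP q → E ⊢ᵖ ∃ᵖ p ⇒ᵖ q
    ?R   : ∀ {α} → E ⊢ᵇ α → E ⊢ᵖ ⁇ α
    ?K   : ∀ {α β} → E ⊢ᵖ ⁇ (α ⇒ᵇ β) ⇒ᵖ ⁇ α ⇒ᵖ ⁇ β
    ?!   : ∀ {p} → E ⊢ᵖ ⁇ (! p) ⇒ᵖ p

  data _⊢ᵇ_ (E : Ext) : Prob → Set where
    axB  : ∀ {α} → BAx E α → E ⊢ᵇ α
    K    : ∀ {α β} → E ⊢ᵇ α ⇒ᵇ β ⇒ᵇ α
    S    : ∀ {α β γ} → E ⊢ᵇ (α ⇒ᵇ β ⇒ᵇ γ) ⇒ᵇ (α ⇒ᵇ β) ⇒ᵇ α ⇒ᵇ γ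
    ∧I   : ∀ {α β} → E ⊢ᵇ α ⇒ᵇ β ⇒ᵇ α ∧ᵇ β
    ∧E₁  : ∀ {α β} → E ⊢ᵇ α ∧ᵇ β ⇒ᵇ α
    ∧E₂  : ∀ {α β} → E ⊢ᵇ α ∧ᵇ β ⇒ᵇ β
    ∨I₁  : ∀ {α β} → E ⊢ᵇ α ⇒ᵇ α ∨ᵇ β
    ∨I₂  : ∀ {α β} → E ⊢ᵇ β ⇒ᵇ α ∨ᵇ β
    ∨E   : ∀ {α β γ} → E ⊢ᵇ (α ⇒ᵇ γ) ⇒ᵇ (β ⇒ᵇ γ) ⇒ᵇ α ∨ᵇ β ⇒ᵇ γ
    ⊥E   : ∀ {α} → E ⊢ᵇ ⊥ᵇ ⇒ᵇ α
    ¬I   : ∀ {α} → E ⊢ᵇ (α ⇒ᵇ ⊥ᵇ) ⇒ᵇ ¬ᵇ α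
    ¬E   : ∀ {α} → E ⊢ᵇ ¬ᵇ α ⇒ᵇ α ⇒ᵇ ⊥ᵇ
    ∀E   : ∀ {α} t → E ⊢ᵇ ∀ᵇ α ⇒ᵇ α [ t ]ᵇ
    ∃I   : ∀ {α} t → E ⊢ᵇ α [ t ]ᵇ ⇒ᵇ ∃ᵇ α
    mp   : ∀ {α β} → E ⊢ᵇ α ⇒ᵇ β → E ⊢ᵇ α → E ⊢ᵇ β
    ∀R   : ∀ {α β} → E ⊢ᵇ wkB β ⇒ᵇ α → E ⊢ᵇ β ⇒ᵇ ∀ᵇ α
    ∃R   : ∀ {α β} → E ⊢ᵇ α ⇒ᵇ wkB β → E ⊢ᵇ ∃ᵇ α ⇒ᵇ β
    !R   : ∀ {p} → E ⊢ᵖ p → E ⊢ᵇ ! p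
    !K   : ∀ {p q} → E ⊢ᵇ ! (p ⇒ᵖ q) ⇒ᵇ ! p ⇒ᵇ ! q
    ¬!0  : E ⊢ᵇ ¬ᵇ (! 𝟘)
    !?   : ∀ {α} → E ⊢ᵇ α ⇒ᵇ ! (⁇ α)

_⊩_ : Ext → Ext → Set
E ⊩ F = (∀ p → PAx F p → E ⊢ᵖ p) × (∀ α → BAx F α → E ⊢ᵇ α)

_≋_ : Ext → Ext → Set
E ≋ F = (E ⊩ F) × (F ⊩ E)

schemeP : (Prop → Set) → Ext
schemeP Sc = record { PAx = Sc ; BAx = λ _ → Empty }

schemeB : (Prob → Set) → Ext
schemeB Sc = record { PAx = λ _ → Empty ; BAx = Sc }

?-Principle : Ext
?-Principle = schemeP λ r → Σ Prob λ α → Σ Prob λ β →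
  r ≡ (⁇ (α ⇒ᵇ β) ⇔ᵖ □ (⁇ α ⇒ᵖ ⁇ β))

?*-Principle : Ext
?*-Principle = schemeP λ r → Σ Prob λ α → Σ Prob λ β →
  r ≡ ((⁇ α ⇒ᵖ ⁇ β) ⇔ᵖ ⁇ (∇ α ⇒ᵇ ∇ β))

?→-Principle : Ext
?→-Principle = schemeP λ r → Σ Prob λ α → Σ Prob λ β →
  r ≡ (⁇ (α ⇒ᵇ β) ⇔ᵖ (⁇ α ⇒ᵖ ⁇ β))

∀-Principle : Ext
∀-Principle = schemeP λ r → Σ Prob λ α →
  r ≡ (⁇ (∀ᵇ α) ⇔ᵖ □ (∀ᵖ ⁇ α))

∀*-Principle : Ext
∀*-Principle = schemeP λ r → Σ Prob λ α →
  r ≡ (∀ᵖ ⁇ α ⇔ᵖ ⁇ (∀ᵇ ∇ α))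

?∀-Principle : Ext
?∀-Principle = schemeP λ r → Σ Prob λ α →
  r ≡ (⁇ (∀ᵇ α) ⇔ᵖ ∀ᵖ ⁇ α)

∨-Principle : Ext
∨-Principle = schemeB λ γ → Σ Prop λ p → Σ Prop λ q →
  γ ≡ (! (p ∨ᵖ q) ⇔ᵇ ∇ (! p ∨ᵇ ! q))

∨*-Principle : Ext
∨*-Principle = schemeB λ γ → Σ Prop λ p → Σ Prop λ q →
  γ ≡ ((! p ∨ᵇ ! q) ⇔ᵇ ! (□ p ∨ᵖ □ q))

!∨-Principle : Ext
!∨-Principle = schemeB λ γ → Σ Prop λ p → Σ Prop λ q →
  γ ≡ (! (p ∨ᵖ q) ⇔ᵇ (! p ∨ᵇ ! q))

∃-Principle : Ext
∃-Principle = schemeB λ γ → Σ Prop λ p →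
  γ ≡ (! (∃ᵖ p) ⇔ᵇ ∇ (∃ᵇ ! p))

∃*-Principle : Ext
∃*-Principle = schemeB λ γ → Σ Prop λ p →
  γ ≡ (∃ᵇ ! p ⇔ᵇ ! (∃ᵖ □ p))

!∃-Principle : Ext
!∃-Principle = schemeB λ γ → Σ Prop λ p →
  γ ≡ (! (∃ᵖ p) ⇔ᵇ ∃ᵇ ! p)

module Submission where

open import Defs
open import Data.Product using (_×_; _,_)
open import Data.Sum using (inj₁; inj₂)
open import Data.Nat using (zero; suc)
open import Data.List using (List; map)
open import Data.List.Properties using (map-∘; map-cong; map-id)
open import Relation.Binary.PropositionalEquality using (_≡_; refl; sym; trans; cong; cong₂; subst)

-- Everything rests on two stability facts. A proposition equivalent to some ?α satisfies
-- p → □p, since ?α → ?!?α = □?α; dually a problem equivalent to some !p satisfies ∇γ → γ,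
-- since ∇!p = !?!p → !p. The ?-, ∀-, ∨- and ∃-principles say that the comparison map is an
-- equivalence up to □ resp. ∇, the starred principles make the relevant side such a formula,
-- and conversely the plain comparison principle, instantiated at ∇α resp. □p, gives the
-- starred ones because ?∇α ↔ ?α and !□p ↔ !p hold in QHC.

map-inverse : (ρ σ : Var → Var) → (∀ x → ρ (σ x) ≡ x) → (xs : List Var) → map ρ (map σ xs) ≡ xs
map-inverse ρ σ h xs = trans (sym (map-∘ xs)) (trans (map-cong h xs) (map-id xs))

lift-inverse : (ρ σ : Var → Var) → (∀ x → ρ (σ x) ≡ x) → ∀ x → lift ρ (lift σ x) ≡ x
lift-inverse ρ σ h zero    = refl
lift-inverse ρ σ h (suc x) = cong suc (h x)

mutual
  renP-inverse : (ρ σ : Var → Var) → (∀ x → ρ (σ x) ≡ x) → (p : Prop) → renP ρ (renP σ p) ≡ p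
  renP-inverse ρ σ h (patom i xs) = cong (patom i) (map-inverse ρ σ h xs)
  renP-inverse ρ σ h (⁇ α)        = cong ⁇_ (renB-inverse ρ σ h α)
  renP-inverse ρ σ h (p ∧ᵖ q)     = cong₂ _∧ᵖ_ (renP-inverse ρ σ h p) (renP-inverse ρ σ h q)
  renP-inverse ρ σ h (p ∨ᵖ q)     = cong₂ _∨ᵖ_ (renP-inverse ρ σ h p) (renP-inverse ρ σ h q)
  renP-inverse ρ σ h (p ⇒ᵖ q)     = cong₂ _⇒ᵖ_ (renP-inverse ρ σ h p) (renP-inverse ρ σ h q)
  renP-inverse ρ σ h (¬ᵖ p)       = cong ¬ᵖ_ (renP-inverse ρ σ h p)
  renP-inverse ρ σ h 𝟘            = refl
  renP-inverse ρ σ h (∀ᵖ p)       = cong ∀ᵖ_ (renP-inverse (lift ρ) (lift σ) (lift-inverse ρ σ h) p)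
  renP-inverse ρ σ h (∃ᵖ p)       = cong ∃ᵖ_ (renP-inverse (lift ρ) (lift σ) (lift-inverse ρ σ h) p)

  renB-inverse : (ρ σ : Var → Var) → (∀ x → ρ (σ x) ≡ x) → (α : Prob) → renB ρ (renB σ α) ≡ α
  renB-inverse ρ σ h (batom i xs) = cong (batom i) (map-inverse ρ σ h xs)
  renB-inverse ρ σ h (! p)        = cong !_ (renP-inverse ρ σ h p)
  renB-inverse ρ σ h (α ∧ᵇ β)     = cong₂ _∧ᵇ_ (renB-inverse ρ σ h α) (renB-inverse ρ σ h β)
  renB-inverse ρ σ h (α ∨ᵇ β)     = cong₂ _∨ᵇ_ (renB-inverse ρ σ h α) (renB-inverse ρ σ h β)
  renB-inverse ρ σ h (α ⇒ᵇ β)     = cong₂ _⇒ᵇ_ (renB-inverse ρ σ h α) (renB-inverse ρ σ h β)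
  renB-inverse ρ σ h (¬ᵇ α)       = cong ¬ᵇ_ (renB-inverse ρ σ h α)
  renB-inverse ρ σ h ⊥ᵇ           = refl
  renB-inverse ρ σ h (∀ᵇ α)       = cong ∀ᵇ_ (renB-inverse (lift ρ) (lift σ) (lift-inverse ρ σ h) α)
  renB-inverse ρ σ h (∃ᵇ α)       = cong ∃ᵇ_ (renB-inverse (lift ρ) (lift σ) (lift-inverse ρ σ h) α)

inst₀-lift-suc : ∀ x → inst 0 (lift suc x) ≡ x
inst₀-lift-suc zero    = refl
inst₀-lift-suc (suc x) = refl

-- The body of wkP (∀ᵖ p) is renP (lift suc) p; instantiating it at 0 recovers p.
inst₀-lift-sucᵖ : (p : Prop) → renP (lift suc) p [ 0 ]ᵖ ≡ p
inst₀-lift-sucᵖ = renP-inverse (inst 0) (lift suc) inst₀-lift-suc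

inst₀-lift-sucᵇ : (α : Prob) → renB (lift suc) α [ 0 ]ᵇ ≡ α
inst₀-lift-sucᵇ = renB-inverse (inst 0) (lift suc) inst₀-lift-suc

module _ {E : Ext} where

  infixr 9 _⨾ᵖ_ _⨾ᵇ_

  _⨾ᵖ_ : ∀ {p q r} → E ⊢ᵖ p ⇒ᵖ q → E ⊢ᵖ q ⇒ᵖ r → E ⊢ᵖ p ⇒ᵖ r
  f ⨾ᵖ g = mp (mp S (mp K g)) f

  _⨾ᵇ_ : ∀ {α β γ} → E ⊢ᵇ α ⇒ᵇ β → E ⊢ᵇ β ⇒ᵇ γ → E ⊢ᵇ α ⇒ᵇ γ
  f ⨾ᵇ g = mp (mp S (mp K g)) f

  ⇒-reflᵖ : ∀ {p} → E ⊢ᵖ p ⇒ᵖ p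
  ⇒-reflᵖ {p} = mp (mp S K) (K {q = p})

  ⇒-monoᵖ : ∀ {p p' q q'} → E ⊢ᵖ p' ⇒ᵖ p → E ⊢ᵖ q ⇒ᵖ q' → E ⊢ᵖ (p ⇒ᵖ q) ⇒ᵖ (p' ⇒ᵖ q')
  ⇒-monoᵖ {p} {p'} {q} f g = precompose ⨾ᵖ mp S (mp K g)
    where
    precompose : E ⊢ᵖ (p ⇒ᵖ q) ⇒ᵖ (p' ⇒ᵖ q)
    precompose = mp (mp S (mp (mp S (mp K S)) K)) (mp K f)

  ⇔-introᵖ : ∀ {p q} → E ⊢ᵖ p ⇒ᵖ q → E ⊢ᵖ q ⇒ᵖ p → E ⊢ᵖ p ⇔ᵖ q
  ⇔-introᵖ f g = mp (mp ∧I f) g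

  ⇔-fwdᵖ : ∀ {p q} → E ⊢ᵖ p ⇔ᵖ q → E ⊢ᵖ p ⇒ᵖ q
  ⇔-fwdᵖ h = mp ∧E₁ h

  ⇔-bwdᵖ : ∀ {p q} → E ⊢ᵖ p ⇔ᵖ q → E ⊢ᵖ q ⇒ᵖ p
  ⇔-bwdᵖ h = mp ∧E₂ h

  ⇔-reflᵖ : ∀ {p} → E ⊢ᵖ p ⇔ᵖ p
  ⇔-reflᵖ = ⇔-introᵖ ⇒-reflᵖ ⇒-reflᵖ

  ⇔-symᵖ : ∀ {p q} → E ⊢ᵖ p ⇔ᵖ q → E ⊢ᵖ q ⇔ᵖ p
  ⇔-symᵖ h = ⇔-introᵖ (⇔-bwdᵖ h) (⇔-fwdᵖ h)

  ⇔-transᵖ : ∀ {p q r} → E ⊢ᵖ p ⇔ᵖ q → E ⊢ᵖ q ⇔ᵖ r → E ⊢ᵖ p ⇔ᵖ r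
  ⇔-transᵖ h k = ⇔-introᵖ (⇔-fwdᵖ h ⨾ᵖ ⇔-fwdᵖ k) (⇔-bwdᵖ k ⨾ᵖ ⇔-bwdᵖ h)

  ⇒-congᵖ : ∀ {p p' q q'} → E ⊢ᵖ p ⇔ᵖ p' → E ⊢ᵖ q ⇔ᵖ q' → E ⊢ᵖ (p ⇒ᵖ q) ⇔ᵖ (p' ⇒ᵖ q')
  ⇒-congᵖ h k = ⇔-introᵖ (⇒-monoᵖ (⇔-bwdᵖ h) (⇔-fwdᵖ k)) (⇒-monoᵖ (⇔-fwdᵖ h) (⇔-bwdᵖ k))

  ∀-monoᵖ : ∀ {p q} → E ⊢ᵖ p ⇒ᵖ q → E ⊢ᵖ ∀ᵖ p ⇒ᵖ ∀ᵖ q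
  ∀-monoᵖ {p} f = ∀R (subst (λ r → E ⊢ᵖ ∀ᵖ renP (lift suc) p ⇒ᵖ r) (inst₀-lift-sucᵖ p) (∀E 0) ⨾ᵖ f)

  ∀-congᵖ : ∀ {p q} → E ⊢ᵖ p ⇔ᵖ q → E ⊢ᵖ ∀ᵖ p ⇔ᵖ ∀ᵖ q
  ∀-congᵖ h = ⇔-introᵖ (∀-monoᵖ (⇔-fwdᵖ h)) (∀-monoᵖ (⇔-bwdᵖ h))

  ⇒-reflᵇ : ∀ {α} → E ⊢ᵇ α ⇒ᵇ α
  ⇒-reflᵇ {α} = mp (mp S K) (K {β = α})

  ⇔-introᵇ : ∀ {α β} → E ⊢ᵇ α ⇒ᵇ β → E ⊢ᵇ β ⇒ᵇ α → E ⊢ᵇ α ⇔ᵇ β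
  ⇔-introᵇ f g = mp (mp ∧I f) g

  ⇔-fwdᵇ : ∀ {α β} → E ⊢ᵇ α ⇔ᵇ β → E ⊢ᵇ α ⇒ᵇ β
  ⇔-fwdᵇ h = mp ∧E₁ h

  ⇔-bwdᵇ : ∀ {α β} → E ⊢ᵇ α ⇔ᵇ β → E ⊢ᵇ β ⇒ᵇ α
  ⇔-bwdᵇ h = mp ∧E₂ h

  ⇔-reflᵇ : ∀ {α} → E ⊢ᵇ α ⇔ᵇ α
  ⇔-reflᵇ = ⇔-introᵇ ⇒-reflᵇ ⇒-reflᵇ

  ⇔-symᵇ : ∀ {α β} → E ⊢ᵇ α ⇔ᵇ β → E ⊢ᵇ β ⇔ᵇ α
  ⇔-symᵇ h = ⇔-introᵇ (⇔-bwdᵇ h) (⇔-fwdᵇ h)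

  ⇔-transᵇ : ∀ {α β γ} → E ⊢ᵇ α ⇔ᵇ β → E ⊢ᵇ β ⇔ᵇ γ → E ⊢ᵇ α ⇔ᵇ γ
  ⇔-transᵇ h k = ⇔-introᵇ (⇔-fwdᵇ h ⨾ᵇ ⇔-fwdᵇ k) (⇔-bwdᵇ k ⨾ᵇ ⇔-bwdᵇ h)

  ∨-elimᵇ : ∀ {α β γ} → E ⊢ᵇ α ⇒ᵇ γ → E ⊢ᵇ β ⇒ᵇ γ → E ⊢ᵇ α ∨ᵇ β ⇒ᵇ γ
  ∨-elimᵇ f g = mp (mp ∨E f) g

  ∨-monoᵇ : ∀ {α α' β β'} → E ⊢ᵇ α ⇒ᵇ α' → E ⊢ᵇ β ⇒ᵇ β' → E ⊢ᵇ α ∨ᵇ β ⇒ᵇ α' ∨ᵇ β'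
  ∨-monoᵇ f g = ∨-elimᵇ (f ⨾ᵇ ∨I₁) (g ⨾ᵇ ∨I₂)

  ∨-congᵇ : ∀ {α α' β β'} → E ⊢ᵇ α ⇔ᵇ α' → E ⊢ᵇ β ⇔ᵇ β' → E ⊢ᵇ α ∨ᵇ β ⇔ᵇ α' ∨ᵇ β'
  ∨-congᵇ h k = ⇔-introᵇ (∨-monoᵇ (⇔-fwdᵇ h) (⇔-fwdᵇ k)) (∨-monoᵇ (⇔-bwdᵇ h) (⇔-bwdᵇ k))

  ∃-monoᵇ : ∀ {α β} → E ⊢ᵇ α ⇒ᵇ β → E ⊢ᵇ ∃ᵇ α ⇒ᵇ ∃ᵇ β
  ∃-monoᵇ {β = β} f = ∃R (f ⨾ᵇ subst (λ γ → E ⊢ᵇ γ ⇒ᵇ ∃ᵇ renB (lift suc) β) (inst₀-lift-sucᵇ β) (∃I 0))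

  ∃-congᵇ : ∀ {α β} → E ⊢ᵇ α ⇔ᵇ β → E ⊢ᵇ ∃ᵇ α ⇔ᵇ ∃ᵇ β
  ∃-congᵇ h = ⇔-introᵇ (∃-monoᵇ (⇔-fwdᵇ h)) (∃-monoᵇ (⇔-bwdᵇ h))

  ⁇-mono : ∀ {α β} → E ⊢ᵇ α ⇒ᵇ β → E ⊢ᵖ ⁇ α ⇒ᵖ ⁇ β
  ⁇-mono f = mp ?K (?R f)

  !-mono : ∀ {p q} → E ⊢ᵖ p ⇒ᵖ q → E ⊢ᵇ ! p ⇒ᵇ ! q
  !-mono f = mp !K (!R f)

  ⁇∀⇒∀⁇ : ∀ {α} → E ⊢ᵖ ⁇ (∀ᵇ α) ⇒ᵖ ∀ᵖ ⁇ α
  ⁇∀⇒∀⁇ {α} = ∀R (⁇-mono (subst (λ β → E ⊢ᵇ ∀ᵇ renB (lift suc) α ⇒ᵇ β) (inst₀-lift-sucᵇ α) (∀E 0)))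

  !∨!⇒!∨ : ∀ {p q} → E ⊢ᵇ ! p ∨ᵇ ! q ⇒ᵇ ! (p ∨ᵖ q)
  !∨!⇒!∨ = ∨-elimᵇ (!-mono ∨I₁) (!-mono ∨I₂)

  ∃!⇒!∃ : ∀ {p} → E ⊢ᵇ ∃ᵇ ! p ⇒ᵇ ! (∃ᵖ p)
  ∃!⇒!∃ {p} = ∃R (!-mono (subst (λ q → E ⊢ᵖ q ⇒ᵖ ∃ᵖ renP (lift suc) p) (inst₀-lift-sucᵖ p) (∃I 0)))

  ⁇⇔□ : ∀ {p α} → E ⊢ᵖ p ⇔ᵖ ⁇ α → E ⊢ᵖ ⁇ α ⇔ᵖ □ p
  ⁇⇔□ h = ⇔-introᵖ (⁇-mono !? ⨾ᵖ ⁇-mono (!-mono (⇔-bwdᵖ h))) (?! ⨾ᵖ ⇔-fwdᵖ h)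

  ⇒□ : ∀ {p α} → E ⊢ᵖ p ⇔ᵖ ⁇ α → E ⊢ᵖ p ⇒ᵖ □ p
  ⇒□ h = ⇔-fwdᵖ h ⨾ᵖ ⇔-fwdᵖ (⁇⇔□ h)

  ⁇⇔□⁇ : ∀ {α} → E ⊢ᵖ ⁇ α ⇔ᵖ □ (⁇ α)
  ⁇⇔□⁇ = ⁇⇔□ ⇔-reflᵖ

  !⇔∇ : ∀ {γ p} → E ⊢ᵇ γ ⇔ᵇ ! p → E ⊢ᵇ ! p ⇔ᵇ ∇ γ
  !⇔∇ h = ⇔-introᵇ (!? ⨾ᵇ !-mono (⁇-mono (⇔-bwdᵇ h))) (!-mono (⁇-mono (⇔-fwdᵇ h) ⨾ᵖ ?!))

  ∇⇒ : ∀ {γ p} → E ⊢ᵇ γ ⇔ᵇ ! p → E ⊢ᵇ ∇ γ ⇒ᵇ γ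
  ∇⇒ h = ⇔-bwdᵇ (!⇔∇ h) ⨾ᵇ ⇔-bwdᵇ h

  !⇔!□ : ∀ {p} → E ⊢ᵇ ! p ⇔ᵇ ! (□ p)
  !⇔!□ = !⇔∇ ⇔-reflᵇ

?∪?*⊩?→ : (?-Principle ∪ ?*-Principle) ⊩ ?→-Principle
?∪?*⊩?→ = (λ { _ (α , β , refl) →
  ⇔-introᵖ ?K (⇒□ (axP (inj₂ (α , β , refl))) ⨾ᵖ ⇔-bwdᵖ (axP (inj₁ (α , β , refl)))) })
  , λ _ ()

?→⊩?∪?* : ?→-Principle ⊩ (?-Principle ∪ ?*-Principle)
?→⊩?∪?* = (λ { _ (inj₁ (α , β , refl)) → ⁇⇔□ (⇔-symᵖ (axP (α , β , refl)))
              ; _ (inj₂ (α , β , refl)) →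
                  ⇔-transᵖ (⇒-congᵖ ⁇⇔□⁇ ⁇⇔□⁇) (⇔-symᵖ (axP (∇ α , ∇ β , refl))) })
  , λ { _ (inj₁ ()) ; _ (inj₂ ()) }

∀∪∀*⊩?∀ : (∀-Principle ∪ ∀*-Principle) ⊩ ?∀-Principle
∀∪∀*⊩?∀ = (λ { _ (α , refl) →
  ⇔-introᵖ ⁇∀⇒∀⁇ (⇒□ (axP (inj₂ (α , refl))) ⨾ᵖ ⇔-bwdᵖ (axP (inj₁ (α , refl)))) })
  , λ _ ()

?∀⊩∀∪∀* : ?∀-Principle ⊩ (∀-Principle ∪ ∀*-Principle)
?∀⊩∀∪∀* = (λ { _ (inj₁ (α , refl)) → ⁇⇔□ (⇔-symᵖ (axP (α , refl)))
              ; _ (inj₂ (α , refl)) → ⇔-transᵖ (∀-congᵖ ⁇⇔□⁇) (⇔-symᵖ (axP (∇ α , refl))) })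
  , λ { _ (inj₁ ()) ; _ (inj₂ ()) }

∨∪∨*⊩!∨ : (∨-Principle ∪ ∨*-Principle) ⊩ !∨-Principle
∨∪∨*⊩!∨ = (λ _ ())
  , λ { _ (p , q , refl) →
  ⇔-introᵇ (⇔-fwdᵇ (axB (inj₁ (p , q , refl))) ⨾ᵇ ∇⇒ (axB (inj₂ (p , q , refl)))) !∨!⇒!∨ }

!∨⊩∨∪∨* : !∨-Principle ⊩ (∨-Principle ∪ ∨*-Principle)
!∨⊩∨∪∨* = (λ { _ (inj₁ ()) ; _ (inj₂ ()) })
  , λ { _ (inj₁ (p , q , refl)) → !⇔∇ (⇔-symᵇ (axB (p , q , refl)))
      ; _ (inj₂ (p , q , refl)) → ⇔-transᵇ (∨-congᵇ !⇔!□ !⇔!□) (⇔-symᵇ (axB (□ p , □ q , refl))) }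

∃∪∃*⊩!∃ : (∃-Principle ∪ ∃*-Principle) ⊩ !∃-Principle
∃∪∃*⊩!∃ = (λ _ ())
  , λ { _ (p , refl) →
  ⇔-introᵇ (⇔-fwdᵇ (axB (inj₁ (p , refl))) ⨾ᵇ ∇⇒ (axB (inj₂ (p , refl)))) ∃!⇒!∃ }

!∃⊩∃∪∃* : !∃-Principle ⊩ (∃-Principle ∪ ∃*-Principle)
!∃⊩∃∪∃* = (λ { _ (inj₁ ()) ; _ (inj₂ ()) })
  , λ { _ (inj₁ (p , refl)) → !⇔∇ (⇔-symᵇ (axB (p , refl)))
      ; _ (inj₂ (p , refl)) → ⇔-transᵇ (∃-congᵇ !⇔!□) (⇔-symᵇ (axB (□ p , refl))) }

mainTheorem5 : ((?-Principle ∪ ?*-Principle) ≋ ?→-Principle)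
    × ((∀-Principle ∪ ∀*-Principle) ≋ ?∀-Principle)
    × ((∨-Principle ∪ ∨*-Principle) ≋ !∨-Principle)
    × ((∃-Principle ∪ ∃*-Principle) ≋ !∃-Principle)
mainTheorem5 = (?∪?*⊩?→ , ?→⊩?∪?*) , (∀∪∀*⊩?∀ , ?∀⊩∀∪∀*)
             , (∨∪∨*⊩!∨ , !∨⊩∨∪∨*) , (∃∪∃*⊩!∃ , !∃⊩∃∪∃*)
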